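{- Let $\mathcal{H}$ be a pseudohalfplane hypergraph on $V$ with witnessing ABA-free hypergraph $\mathcal{F}$. (i) If a topset $H\in\mathcal{H}$ contains every bottomvertex, then $H=V$; if a bottomset $H\in\mathcal{H}$ contains every topvertex, then $H=V$. (ii) If a hyperedge $H\in\mathcal{H}$ contains every extremal vertex, then $H=V$.
   Context: Let $V$ be a finite totally ordered set. A hypergraph $\mathcal{F}$ on $V$ is ABA-free if there are no two hyperedges $A,B\in\mathcal{F}$ and vertices $x<y<z$ with $x,z\in A\setminus B$ and $y\in B\setminus A$. Let $\bar{\mathcal{F}}=\{V\setminus F: F\in\mathcal{F}\}$. $\mathcal{H}$ is a pseudohalfplane hypergraph if $\mathcal{H}\subseteq\mathcal{F}\cup\bar{\mathcal{F}}$ for some ABA-free $\mathcal{F}$ on $V$; fix such an $\mathcal{F}$. Hyperedges of $\mathcal{H}$ in $\mathcal{F}$ are topsets, those in $\bar{\mathcal{F}}$ are bottomsets. A vertex $a$ is skippable in a hypergraph $\mathcal{G}$ on $V$ if some $A\in\mathcal{G}$ has $\min(A)<a<\max(A)$ and $a\notin A$, and unskippable otherwise. Topvertices are the unskippable vertices of $\mathcal{F}$, bottomvertices are the unskippable vertices of $\bar{\mathcal{F}}$, and extremal vertices are the vertices that are topvertices or bottomvertices. -}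

module Defs where

open import Data.Nat using (ℕ)
open import Data.Fin using (Fin; _<_)
open import Data.Fin.Subset using (Subset; _∈_; _∉_; ∁; ⊤)
open import Data.List using (List; map)
import Data.List.Membership.Propositional as LM
open import Data.Product using (Σ; _×_; ∃)
open import Data.Sum using (_⊎_)
open import Relation.Nullary using (¬_)

-- The ground set V is Fin n with its standard total order.
-- A hypergraph on V is a finite list of hyperedges (subsets of V).
Hypergraph : ℕ → Set
Hypergraph n = List (Subset n)

_∈ₕ_ : ∀ {n} → Subset n → Hypergraph n → Set
A ∈ₕ 𝓖 = A LM.∈ 𝓖

ABAFree : ∀ {n} → Hypergraph n → Set
ABAFree {n} 𝓕 = ∀ (A B : Subset n) → A ∈ₕ 𝓕 → B ∈ₕ 𝓕 →
  ∀ (x y z : Fin n) → x < y → y < z →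
  ¬ ((x ∈ A × x ∉ B) × (z ∈ A × z ∉ B) × (y ∈ B × y ∉ A))

bar : ∀ {n} → Hypergraph n → Hypergraph n
bar 𝓕 = map ∁ 𝓕

PseudohalfplaneWitness : ∀ {n} → Hypergraph n → Hypergraph n → Set
PseudohalfplaneWitness 𝓗 𝓕 =
  ABAFree 𝓕 × (∀ H → H ∈ₕ 𝓗 → H ∈ₕ 𝓕 ⊎ H ∈ₕ bar 𝓕)

-- a is skippable in 𝓖: some A ∈ 𝓖 with min A < a < max A and a ∉ A
-- (min A < a < max A unfolded as: some x, z ∈ A with x < a < z)
Skippable : ∀ {n} → Hypergraph n → Fin n → Set
Skippable {n} 𝓖 a = Σ (Subset n) λ A → A ∈ₕ 𝓖 ×
  Σ (Fin n) λ x → Σ (Fin n) λ z → x ∈ A × z ∈ A × x < a × a < z × a ∉ A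

Unskippable : ∀ {n} → Hypergraph n → Fin n → Set
Unskippable 𝓖 a = ¬ Skippable 𝓖 a

Topvertex : ∀ {n} → Hypergraph n → Fin n → Set
Topvertex 𝓕 a = Unskippable 𝓕 a

Bottomvertex : ∀ {n} → Hypergraph n → Fin n → Set
Bottomvertex 𝓕 a = Unskippable (bar 𝓕) a

Extremal : ∀ {n} → Hypergraph n → Fin n → Set
Extremal 𝓕 a = Topvertex 𝓕 a ⊎ Bottomvertex 𝓕 a

Topset : ∀ {n} → Hypergraph n → Hypergraph n → Subset n → Set
Topset 𝓗 𝓕 H = H ∈ₕ 𝓗 × H ∈ₕ 𝓕

Bottomset : ∀ {n} → Hypergraph n → Hypergraph n → Subset n → Set
Bottomset 𝓗 𝓕 H = H ∈ₕ 𝓗 × H ∈ₕ bar 𝓕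

-- Let 𝓖 be ABA-free. Any hyperedge S ∈ 𝓖 meets the unskippable vertices of 𝓖
-- unless S = ∅. This is shown for the prefixes {0, …, k-1} by induction on k,
-- skippability being witnessed inside the prefix. If p ∈ S is only skipped by a
-- hyperedge W whose right witness is the new vertex k, then k ∉ S and ABA-freeness
-- of (W, S) force W ∩ {0, …, k-1} into S ∩ {0, …, p-1}; so W violates the claim
-- for k, with smaller vertices of S as the skipped ones (well-founded induction on p).
-- Applied to 𝓕 and to F̄, which is again ABA-free, this gives (i), and (ii) follows.
module Submission where

open import Defs
open import Data.Nat using (ℕ)
open import Data.Fin using (Fin)
open import Data.Fin.Subset using (Subset; _∈_; ⊤)
open import Data.Product using (_×_)
open import Relation.Binary.PropositionalEquality using (_≡_)

open import Data.Nat as ℕ using (zero; suc)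
open import Data.Nat.Properties using (≤-pred; ≤-reflexive; m≤n⇒m<n∨m≡n; m<n⇒m<1+n; <-trans; <-≤-trans; <-irrefl; <-cmp)
open import Data.Fin using (toℕ; _<_)
open import Data.Fin.Properties using (toℕ<n; toℕ-injective)
open import Data.Fin.Induction using (<-wellFounded)
open import Data.Fin.Subset using (_∉_; ∁)
open import Data.Fin.Subset.Properties using (_∈?_; x∈∁p⇒x∉p; x∉p⇒x∈∁p; x∉∁p⇒x∈p; x∈p⇒x∉∁p; ⊆-antisym; ⊆⊤)
open import Data.List.Membership.Propositional.Properties using (∈-map⁺; ∈-map⁻)
open import Data.Product using (Σ; _,_)
open import Data.Sum using (inj₁; inj₂)
open import Data.Empty using (⊥; ⊥-elim)
open import Function using (_∘_)
open import Induction.WellFounded using (Acc; acc)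
open import Relation.Nullary using (¬_)
open import Relation.Nullary.Decidable using (decidable-stable)
open import Relation.Binary using (tri<; tri≈; tri>)
open import Relation.Binary.PropositionalEquality using (refl; sym; subst)

SkippedBelow : ∀ {n} → Hypergraph n → ℕ → Fin n → Set
SkippedBelow {n} 𝓖 k a = Σ (Subset n) λ A → A ∈ₕ 𝓖 ×
  Σ (Fin n) λ x → Σ (Fin n) λ z → x ∈ A × z ∈ A × x < a × a < z × toℕ z ℕ.< k × a ∉ A

skippable⇒skippedBelow : ∀ {n} {𝓖 : Hypergraph n} {a} → Skippable 𝓖 a → SkippedBelow 𝓖 n a
skippable⇒skippedBelow (A , A∈ , x , z , x∈A , z∈A , x<a , a<z , a∉A) =
  A , A∈ , x , z , x∈A , z∈A , x<a , a<z , toℕ<n z , a∉A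

¬skippedBelow-last : ∀ {n} {𝓖 : Hypergraph n} {k a} → toℕ a ≡ k → ¬ SkippedBelow 𝓖 (suc k) a
¬skippedBelow-last a≡k (_ , _ , _ , _ , _ , _ , _ , a<z , z<k+1 , _) =
  <-irrefl refl (<-≤-trans a<z (≤-pred (subst (λ t → toℕ _ ℕ.< suc t) (sym a≡k) z<k+1)))

ABAFree-bar : ∀ {n} {𝓕 : Hypergraph n} → ABAFree 𝓕 → ABAFree (bar 𝓕)
ABAFree-bar aba A' B' A'∈ B'∈ x y z x<y y<z ((x∈A' , x∉B') , (z∈A' , z∉B') , (y∈B' , y∉A'))
  with ∈-map⁻ ∁ A'∈ | ∈-map⁻ ∁ B'∈
... | A , A∈ , refl | B , B∈ , refl =
  aba B A B∈ A∈ x y z x<y y<z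
    ( (x∉∁p⇒x∈p x∉B' , x∈∁p⇒x∉p x∈A')
    , (x∉∁p⇒x∈p z∉B' , x∈∁p⇒x∉p z∈A')
    , (x∉∁p⇒x∈p y∉A' , x∈∁p⇒x∉p y∈B') )

∀∈⇒≡⊤ : ∀ {n} {H : Subset n} → (∀ a → a ∈ H) → H ≡ ⊤
∀∈⇒≡⊤ all∈ = ⊆-antisym ⊆⊤ (λ {a} _ → all∈ a)

module _ {n} {𝓖 : Hypergraph n} (aba : ABAFree 𝓖) where

  ABAFree-∈-left : ∀ {A B c p z} → A ∈ₕ 𝓖 → B ∈ₕ 𝓖 → p < z →
                   p ∈ B → p ∉ A → z ∈ A → z ∉ B → c ∈ A → c < p → c ∈ B
  ABAFree-∈-left {A} {B} {c} {p} {z} A∈ B∈ p<z p∈B p∉A z∈A z∉B c∈A c<p =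
    decidable-stable (c ∈? B) λ c∉B →
      aba A B A∈ B∈ c p z c<p p<z ((c∈A , c∉B) , (z∈A , z∉B) , (p∈B , p∉A))

  PrefixSkipped : ℕ → Subset n → Set
  PrefixSkipped k S = ∀ c → c ∈ S → toℕ c ℕ.< k → ¬ ¬ SkippedBelow 𝓖 k c

  PrefixEmpty : ℕ → Subset n → Set
  PrefixEmpty k S = ∀ c → c ∈ S → toℕ c ℕ.< k → ⊥

  prefixSkipped-pred : ∀ {k S} →
    (∀ {T} → T ∈ₕ 𝓖 → PrefixSkipped k T → PrefixEmpty k T) →
    S ∈ₕ 𝓖 → PrefixSkipped (suc k) S → PrefixSkipped k S
  prefixSkipped-pred {k} {S} ih S∈ skipped p p∈S p<k = go p (<-wellFounded p) p∈S p<k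
    where
    go : ∀ p → Acc _<_ p → p ∈ S → toℕ p ℕ.< k → ¬ ¬ SkippedBelow 𝓖 k p
    go p (acc rs) p∈S p<k ¬skipped = skipped p p∈S (m<n⇒m<1+n p<k) skippedAtLast
      where
      skippedAtLast : ¬ SkippedBelow 𝓖 (suc k) p
      skippedAtLast (W , W∈ , x , z , x∈W , z∈W , x<p , p<z , z<k+1 , p∉W)
        with m≤n⇒m<n∨m≡n (≤-pred z<k+1)
      ... | inj₁ z<k = ¬skipped (W , W∈ , x , z , x∈W , z∈W , x<p , p<z , z<k , p∉W)
      ... | inj₂ z≡k = ih W∈ W-skipped x x∈W (<-trans x<p p<k)
        where
        z∉S : z ∉ S
        z∉S z∈S = skipped z z∈S (ℕ.s≤s (≤-reflexive z≡k)) (¬skippedBelow-last z≡k)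

        below-p : ∀ {c} → c ∈ W → toℕ c ℕ.< k → c < p
        below-p {c} c∈W c<k with <-cmp (toℕ c) (toℕ p)
        ... | tri< c<p _ _ = c<p
        ... | tri≈ _ c≡p _ = ⊥-elim (p∉W (subst (_∈ W) (toℕ-injective c≡p) c∈W))
        ... | tri> _ _ p<c = ⊥-elim (¬skipped (W , W∈ , x , c , x∈W , c∈W , x<p , p<c , c<k , p∉W))

        W-skipped : PrefixSkipped k W
        W-skipped c c∈W c<k =
          go c (rs (below-p c∈W c<k))
             (ABAFree-∈-left W∈ S∈ p<z p∈S p∉W z∈W z∉S c∈W (below-p c∈W c<k)) c<k

  prefixSkipped⇒prefixEmpty : ∀ k {S} → S ∈ₕ 𝓖 → PrefixSkipped k S → PrefixEmpty k S
  prefixSkipped⇒prefixEmpty zero    S∈ skipped c c∈S ()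
  prefixSkipped⇒prefixEmpty (suc k) S∈ skipped c c∈S c<k+1 with m≤n⇒m<n∨m≡n (≤-pred c<k+1)
  ... | inj₁ c<k = prefixSkipped⇒prefixEmpty k S∈
                     (prefixSkipped-pred (prefixSkipped⇒prefixEmpty k) S∈ skipped) c c∈S c<k
  ... | inj₂ c≡k = skipped c c∈S c<k+1 (¬skippedBelow-last c≡k)

  unskippable-free⇒empty : ∀ {S} → S ∈ₕ 𝓖 → (∀ a → Unskippable 𝓖 a → a ∉ S) → ∀ a → a ∉ S
  unskippable-free⇒empty S∈ avoids a a∈S =
    prefixSkipped⇒prefixEmpty n S∈
      (λ c c∈S _ ¬skipped → avoids c (¬skipped ∘ skippable⇒skippedBelow) c∈S)
      a a∈S (toℕ<n a)

topset-⊇bottomvertices⇒≡⊤ : ∀ {n} {𝓕 : Hypergraph n} {H} → ABAFree 𝓕 → H ∈ₕ 𝓕 →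
                            (∀ a → Bottomvertex 𝓕 a → a ∈ H) → H ≡ ⊤
topset-⊇bottomvertices⇒≡⊤ {H = H} aba H∈ ⊇bottom = ∀∈⇒≡⊤ λ a →
  x∉∁p⇒x∈p (unskippable-free⇒empty (ABAFree-bar aba) (∈-map⁺ ∁ H∈)
             (λ b bottom → x∈p⇒x∉∁p (⊇bottom b bottom)) a)

bottomset-⊇topvertices⇒≡⊤ : ∀ {n} {𝓕 : Hypergraph n} {H} → ABAFree 𝓕 → H ∈ₕ bar 𝓕 →
                            (∀ a → Topvertex 𝓕 a → a ∈ H) → H ≡ ⊤
bottomset-⊇topvertices⇒≡⊤ aba H∈ ⊇top with ∈-map⁻ ∁ H∈
... | A , A∈ , refl = ∀∈⇒≡⊤ λ a →
  x∉p⇒x∈∁p (unskippable-free⇒empty aba A∈ (λ t top → x∈∁p⇒x∉p (⊇top t top)) a)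

mainTheorem18 : ∀ (n : ℕ) (𝓗 𝓕 : Hypergraph n) → PseudohalfplaneWitness 𝓗 𝓕 →
    ((∀ (H : Subset n) → Topset 𝓗 𝓕 H → (∀ (a : Fin n) → Bottomvertex 𝓕 a → a ∈ H) → H ≡ ⊤)
     × (∀ (H : Subset n) → Bottomset 𝓗 𝓕 H → (∀ (a : Fin n) → Topvertex 𝓕 a → a ∈ H) → H ≡ ⊤))
    × (∀ (H : Subset n) → H ∈ₕ 𝓗 → (∀ (a : Fin n) → Extremal 𝓕 a → a ∈ H) → H ≡ ⊤)
mainTheorem18 n 𝓗 𝓕 (aba , top-or-bottom) =
  ( (λ H (_ , H∈𝓕) → topset-⊇bottomvertices⇒≡⊤ aba H∈𝓕)
  , (λ H (_ , H∈𝓕̄) → bottomset-⊇topvertices⇒≡⊤ aba H∈𝓕̄) )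
  , extremal
  where
  extremal : ∀ H → H ∈ₕ 𝓗 → (∀ a → Extremal 𝓕 a → a ∈ H) → H ≡ ⊤
  extremal H H∈ ⊇extremal with top-or-bottom H H∈
  ... | inj₁ H∈𝓕 = topset-⊇bottomvertices⇒≡⊤ aba H∈𝓕 (λ a → ⊇extremal a ∘ inj₂)
  ... | inj₂ H∈𝓕̄ = bottomset-⊇topvertices⇒≡⊤ aba H∈𝓕̄ (λ a → ⊇extremal a ∘ inj₁)
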